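{- For any integers $n,m\ge 2$, the arc set of the strong product $\overrightarrow{C}_n\boxtimes\overrightarrow{C}_m$ can be partitioned into two sets $A_1,A_2$ such that both spanning subdigraphs $(V,A_1)$ and $(V,A_2)$ are strong, where $V$ is the vertex set of $\overrightarrow{C}_n\boxtimes\overrightarrow{C}_m$.
   Context: $\overrightarrow{C}_n$ is the directed cycle on $n$ vertices ($\overrightarrow{C}_2$ is two vertices with both opposite arcs). A digraph is strong if for every ordered pair of distinct vertices $x,y$ there is a directed path from $x$ to $y$. The strong product $G\boxtimes H$ has vertex set $V(G)\times V(H)$ and an arc $(x,x')(y,y')$ whenever either $xy\in A(G)$ and $x'=y'$, or $x=y$ and $x'y'\in A(H)$, or $xy\in A(G)$ and $x'y'\in A(H)$. -}

module Defs where

open import Data.Nat using (ℕ; suc)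
open import Data.Fin using (Fin; toℕ)
open import Data.Bool using (Bool; true; false)
open import Data.Product using (_×_; _,_; Σ)
open import Data.Sum using (_⊎_)
open import Relation.Binary.PropositionalEquality using (_≡_)
open import Relation.Nullary using (¬_)
open import Relation.Binary.Construct.Closure.ReflexiveTransitive using (Star)

Digraph : Set → Set₁
Digraph V = V → V → Set

-- Directed cycle on n vertices 0,1,…,n-1 with arcs i → i+1 (mod n).
-- For n = 2 this gives both arcs 0→1 and 1→0.
cycleArc : (n : ℕ) → Digraph (Fin n)
cycleArc n x y = (toℕ y ≡ suc (toℕ x)) ⊎ (suc (toℕ x) ≡ n × toℕ y ≡ 0)

strongProd : {U W : Set} → Digraph U → Digraph W → Digraph (U × W)
strongProd G H (x , x′) (y , y′) =
  (G x y × x′ ≡ y′) ⊎ ((x ≡ y × H x′ y′) ⊎ (G x y × H x′ y′))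

Strong : {V : Set} → Digraph V → Set
Strong {V} G = (x y : V) → ¬ (x ≡ y) → Star G x y

colourClass : {V : Set} (G : Digraph V) →
  ((x y : V) → G x y → Bool) → Bool → Digraph V
colourClass G c b x y = Σ (G x y) λ a → c x y a ≡ b

-- Colour the horizontal arcs and the vertical arcs of column 0 with the first
-- colour, and the diagonal arcs and the remaining vertical arcs with the second.
-- The first class contains every row cycle and the column-0 cycle, so one can go
-- along a row to column 0, up that column, and along a row again.  In the second
-- class every horizontal walk lifts to a diagonal walk (each vertex of a cycle
-- has an out-arc), after which a vertical walk fixes the row; this reaches every
-- column except 0, and column 0 is entered by one diagonal arc from column n - 1.
module Submission where

open import Defs
open import Data.Nat using (ℕ; zero; suc; _≥_; s≤s)
open import Data.Fin using (Fin; zero; suc; toℕ; fromℕ; inject₁)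
open import Data.Fin.Properties using (toℕ-fromℕ; toℕ-inject₁)
open import Data.Fin.Relation.Unary.Top using (view; ‵fromℕ; ‵inject₁)
open import Data.Bool using (Bool; true; false)
open import Data.Product using (Σ; ∃; _×_; _,_)
open import Data.Sum using (inj₁; inj₂)
open import Relation.Binary.PropositionalEquality using (_≡_; refl; sym; cong)
open import Relation.Binary.Construct.Closure.ReflexiveTransitive
  using (Star; ε; _◅_; _◅◅_; gmap; map)

Succ : ∀ {n} → Fin n → Fin n → Set
Succ x y = toℕ y ≡ suc (toℕ x)

suc-Succ : ∀ {n} {x y : Fin n} → Succ x y → Succ (suc x) (suc y)
suc-Succ = cong suc

inject₁-Succ : ∀ {n} (j : Fin n) → Succ (inject₁ j) (suc j)
inject₁-Succ j = cong suc (sym (toℕ-inject₁ j))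

walk-to-last : ∀ {k} (x : Fin (suc k)) → Star Succ x (fromℕ k)
walk-to-last {zero}  zero    = ε
walk-to-last {suc k} zero    = refl ◅ gmap suc suc-Succ (walk-to-last zero)
walk-to-last {suc k} (suc x) = gmap suc suc-Succ (walk-to-last x)

walk-from-zero : ∀ {k} (y : Fin (suc k)) → Star Succ zero y
walk-from-zero         zero    = ε
walk-from-zero {suc k} (suc y) = refl ◅ gmap suc suc-Succ (walk-from-zero y)

cycle-wrap : ∀ {k} → cycleArc (suc k) (fromℕ k) zero
cycle-wrap {k} = inj₂ (cong suc (toℕ-fromℕ k) , refl)

cycle-successor : ∀ {k} (x : Fin (suc k)) → ∃ (cycleArc (suc k) x)
cycle-successor x with view x
... | ‵fromℕ     = zero , cycle-wrap
... | ‵inject₁ j = suc j , inj₁ (inject₁-Succ j)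

cycle-predecessor : ∀ {k} (y : Fin (suc k)) → ∃ λ x → cycleArc (suc k) x y
cycle-predecessor zero    = fromℕ _ , cycle-wrap
cycle-predecessor (suc j) = inject₁ j , inj₁ (inject₁-Succ j)

cycle-connected : ∀ {k} (x y : Fin (suc k)) → Star (cycleArc (suc k)) x y
cycle-connected x y =
  map inj₁ (walk-to-last x) ◅◅ cycle-wrap ◅ map inj₁ (walk-from-zero y)

module Decomposition {U W : Set} (G : Digraph U) (H : Digraph W) (hub : U → Bool) where

  Arc : Digraph (U × W)
  Arc = strongProd G H

  colouring : (x y : U × W) → Arc x y → Bool
  colouring _       _ (inj₁ _)        = true
  colouring (x , _) _ (inj₂ (inj₁ _)) = hub x
  colouring _       _ (inj₂ (inj₂ _)) = false

  Class : Bool → Digraph (U × W)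
  Class = colourClass Arc colouring

  horizontal-walk : ∀ {a b} j → Star G a b → Star (Class true) (a , j) (b , j)
  horizontal-walk j = gmap (_, j) λ g → inj₁ (g , refl) , refl

  vertical-walk : ∀ {a c j j′} → hub a ≡ c → Star H j j′ → Star (Class c) (a , j) (a , j′)
  vertical-walk {a} hub-a = gmap (a ,_) λ h → inj₂ (inj₁ (refl , h)) , hub-a

  diagonal-arc : ∀ {a b j j′} → G a b → H j j′ → Class false (a , j) (b , j′)
  diagonal-arc g h = inj₂ (inj₂ (g , h)) , refl

  diagonal-walk : (∀ j → ∃ (H j)) →
    ∀ {a b} → Star G a b → ∀ j → ∃ λ j′ → Star (Class false) (a , j) (b , j′)
  diagonal-walk out ε       j = j , ε
  diagonal-walk out (g ◅ p) j =
    let j₁ , h = out j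
        j′ , q = diagonal-walk out p j₁
    in j′ , diagonal-arc g h ◅ q

  first-class-strong : (∀ a b → Star G a b) → (∀ j j′ → Star H j j′) →
    (h : U) → hub h ≡ true → Strong (Class true)
  first-class-strong G-conn H-conn h hub-h (a , j) (b , j′) _ =
    horizontal-walk j (G-conn a h) ◅◅ vertical-walk hub-h (H-conn j j′)
      ◅◅ horizontal-walk j′ (G-conn h b)

  second-class-reaches-column : (∀ a b → Star G a b) → (∀ j j′ → Star H j j′) →
    (∀ j → ∃ (H j)) → ∀ {b} → hub b ≡ false →
    ∀ a j j′ → Star (Class false) (a , j) (b , j′)
  second-class-reaches-column G-conn H-conn out {b} hub-b a j j′ =
    let j₁ , p = diagonal-walk out (G-conn a b) j
    in p ◅◅ vertical-walk hub-b (H-conn j₁ j′)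

  second-class-strong : (∀ a b → Star G a b) → (∀ j j′ → Star H j j′) →
    (∀ j → ∃ (H j)) → (∀ j′ → ∃ λ j → H j j′) →
    (∀ b → hub b ≡ true → ∃ λ a → G a b × hub a ≡ false) → Strong (Class false)
  second-class-strong G-conn H-conn out into entry (a , j) (b , j′) _ with hub b in hub-b
  ... | false = second-class-reaches-column G-conn H-conn out hub-b a j j′
  ... | true  =
    let c , g , hub-c = entry b hub-b
        i , h         = into j′
    in second-class-reaches-column G-conn H-conn out hub-c a j i ◅◅ diagonal-arc g h ◅ ε

isZero : ∀ {n} → Fin n → Bool
isZero zero    = true
isZero (suc _) = false

cycle-product-decomposition : ∀ a k →
  let open Decomposition (cycleArc (suc (suc a))) (cycleArc (suc k)) isZero in
  Strong (Class true) × Strong (Class false)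
cycle-product-decomposition a k =
    first-class-strong cycle-connected cycle-connected zero refl
  , second-class-strong cycle-connected cycle-connected
      cycle-successor cycle-predecessor entry
  where
  open Decomposition (cycleArc (suc (suc a))) (cycleArc (suc k)) isZero
  entry : ∀ b → isZero b ≡ true → ∃ λ c → cycleArc (suc (suc a)) c b × isZero c ≡ false
  entry zero _ = fromℕ (suc a) , cycle-wrap , refl

lemma3p5 : (n m : ℕ) → (hn : n ≥ 2) → (hm : m ≥ 2) →
    Σ ((x y : Fin n × Fin m) → strongProd (cycleArc n) (cycleArc m) x y → Bool) λ c →
    Strong (colourClass (strongProd (cycleArc n) (cycleArc m)) c true)
    × Strong (colourClass (strongProd (cycleArc n) (cycleArc m)) c false)
lemma3p5 (suc (suc a)) (suc k) _ _ =
  Decomposition.colouring (cycleArc (suc (suc a))) (cycleArc (suc k)) isZero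
  , cycle-product-decomposition a k
lemma3p5 (suc (suc a)) zero _ ()
lemma3p5 (suc zero)    _    (s≤s ()) _
lemma3p5 zero          _    ()       _
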